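{- Let ${\cal F}=\{F_i\mid i\in I\}\subseteq{\cal T}'$, let $\approx$ be the congruence on ${\cal T}'$ generated by ${\cal F}$ and $\approx^{\circ}$ the congruence on ${\cal T}$ generated by $\{F_i^{\circ}\mid i\in I\}$. If $\Gamma\vdash M:A$ is derivable in ${\cal S}^{\rightarrow\wedge\vee}_{\approx}$, then $\Gamma^{\circ}\vdash M^{\circ}:A^{\circ}$ is derivable in ${\cal S}^{\mu}_{\approx^{\circ}}$, where $\Gamma^{\circ}$ is obtained from $\Gamma$ by replacing all types by their translations and adding the declaration $\varphi:\neg\bot$.
   Context: Let ${\cal A}$ be a set of atomic constants containing a specified subset ${\cal X}=\{X_i\mid i\in I\}$. ${\cal T}'$: $A ::= X\mid\bot\mid A\rightarrow A\mid A\wedge A\mid A\vee A$; ${\cal T}$: types built with $\rightarrow$ only; $\neg A:=A\rightarrow\bot$. The congruence generated by $\{G_i\}$ is the least equivalence relation compatible with the connectives such that $X_i\approx G_i$. Type translation: $A^{\circ}=A$ for atomic $A$ and $\bot$; $(A_1\rightarrow A_2)^{\circ}=A_1^{\circ}\rightarrow A_2^{\circ}$; $(A_1\wedge A_2)^{\circ}=\neg(A_1^{\circ}\rightarrow(A_2^{\circ}\rightarrow\bot))$; $(A_1\vee A_2)^{\circ}=\neg A_1^{\circ}\rightarrow(\neg A_2^{\circ}\rightarrow\bot)$. Terms (with term variables $x$ and $\mu$-variables $\alpha$, and a special $\mu$-variable $\varphi$): $\lambda\mu^{\rightarrow\wedge\vee}$-terms $M ::= x \mid \lambda x.M \mid (M\;\varepsilon)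 \mid \langle M,M\rangle \mid \omega_1 M \mid \omega_2 M \mid \mu\alpha.M \mid (\alpha\; M)$, $\varepsilon ::= M \mid \pi_1 \mid \pi_2 \mid [x_1.M, x_2.M]$; $\lambda\mu$-terms $M ::= x \mid \lambda x.M\mid (M\;M)\mid\mu\alpha.M\mid(\alpha\;M)$. Term translation: $x^{\circ}=x$; $(\lambda x.M)^{\circ}=\lambda x.M^{\circ}$; $(M\;N)^{\circ}=(M^{\circ}\;N^{\circ})$; $(\mu\alpha.M)^{\circ}=\mu\alpha.M^{\circ}$; $(\alpha\;M)^{\circ}=(\alpha\;M^{\circ})$; $\langle M,N\rangle^{\circ}=\lambda x.(x\;M^{\circ}\;N^{\circ})$; $(M\;\pi_i)^{\circ}=\mu\alpha.(\varphi\;(M^{\circ}\;\lambda x_1.\lambda x_2.\mu\gamma.(\alpha\;x_i)))$; $(M\;[x_1.N_1,x_2.N_2])^{\circ}=\mu\alpha.(\varphi\;(M^{\circ}\;\lambda x_1.\mu\gamma.(\alpha\;N_1^{\circ})\;\lambda x_2.\mu\gamma.(\alpha\;N_2^{\circ})))$; $(\omega_iM)^{\circ}=\lambda x_1.\lambda x_2.(x_i\;M^{\circ})$ (bound $\alpha,\gamma,x$ fresh). Contexts: declarations $x:A$, $\alpha:\neg B$, each variable at most once. ${\cal S}^{\mu}_{\approx^{\circ}}$ (on $\lambda\mu$-terms, types in ${\cal T}$): $\Gamma,x:A\vdash x:A$; $\Gamma,x:A\vdash M:B\Rightarrow\Gamma\vdash\lambda x.M:A\rightarrow B$; $\Gamma\vdash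 M:A\rightarrow B$, $\Gamma\vdash N:A\Rightarrow\Gamma\vdash(M\;N):B$; $\Gamma,\alpha:\neg A\vdash M:A\Rightarrow\Gamma,\alpha:\neg A\vdash(\alpha\;M):\bot$; $\Gamma,\alpha:\neg A\vdash M:\bot\Rightarrow\Gamma\vdash\mu\alpha.M:A$; $\Gamma\vdash M:A$, $A\approx^{\circ}B\Rightarrow\Gamma\vdash M:B$. ${\cal S}^{\rightarrow\wedge\vee}_{\approx}$ (on $\lambda\mu^{\rightarrow\wedge\vee}$-terms, types in ${\cal T}'$): the same first five rules, plus $\Gamma\vdash M:A_1$, $\Gamma\vdash N:A_2\Rightarrow\Gamma\vdash\langle M,N\rangle:A_1\wedge A_2$; $\Gamma\vdash M:A_1\wedge A_2\Rightarrow\Gamma\vdash(M\;\pi_i):A_i$; $\Gamma\vdash M:A_j\Rightarrow\Gamma\vdash\omega_jM:A_1\vee A_2$; $\Gamma\vdash M:A_1\vee A_2$, $\Gamma,x_1:A_1\vdash N_1:C$, $\Gamma,x_2:A_2\vdash N_2:C\Rightarrow\Gamma\vdash(M\;[x_1.N_1,x_2.N_2]):C$; and $\Gamma\vdash M:A$, $A\approx B\Rightarrow\Gamma\vdash M:B$. -}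

module Defs where

open import Data.Nat using (ℕ; suc; _+_; _<_)
open import Data.Product using (Σ; _×_; ∃)
open import Data.List using (List; []; _∷_; map)
open import Data.List.Membership.Propositional using (_∈_)
open import Data.List.Relation.Unary.All using (All)
open import Relation.Binary.PropositionalEquality using (_≡_)
open import Relation.Nullary using (¬_)

data Ty' (Atom : Set) : Set where
  at   : Atom → Ty' Atom
  ⊥'   : Ty' Atom
  _⇒_  : Ty' Atom → Ty' Atom → Ty' Atom
  _∧_  : Ty' Atom → Ty' Atom → Ty' Atom
  _∨_  : Ty' Atom → Ty' Atom → Ty' Atom

data Ty (Atom : Set) : Set where
  at   : Atom → Ty Atom
  ⊥'   : Ty Atom
  _⇒_  : Ty Atom → Ty Atom → Ty Atom

¬' : ∀ {Atom} → Ty Atom → Ty Atom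
¬' A = A ⇒ ⊥'

¬'' : ∀ {Atom} → Ty' Atom → Ty' Atom
¬'' A = A ⇒ ⊥'

_° : ∀ {Atom} → Ty' Atom → Ty Atom
at a ° = at a
⊥' ° = ⊥'
(A ⇒ B) ° = (A °) ⇒ (B °)
(A ∧ B) ° = ¬' ((A °) ⇒ ((B °) ⇒ ⊥'))
(A ∨ B) ° = ¬' (A °) ⇒ (¬' (B °) ⇒ ⊥')

-- Terms.  Term variables and μ-variables are natural numbers (two
-- separate namespaces).

data Tm' : Set where
  var   : ℕ → Tm'
  lam   : ℕ → Tm' → Tm'
  app   : Tm' → Tm' → Tm'
  proj₁ : Tm' → Tm'
  proj₂ : Tm' → Tm'
  case  : Tm' → ℕ → Tm' → ℕ → Tm' → Tm'       -- (M [x₁.N₁ , x₂.N₂])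
  pair  : Tm' → Tm' → Tm'
  ω₁    : Tm' → Tm'
  ω₂    : Tm' → Tm'
  mu    : ℕ → Tm' → Tm'
  name  : ℕ → Tm' → Tm'

data MVar : Set where
  φ : MVar
  ν : ℕ → MVar

data Tm : Set where
  var   : ℕ → Tm
  lam   : ℕ → Tm → Tm
  app   : Tm → Tm → Tm
  mu    : MVar → Tm → Tm
  name  : MVar → Tm → Tm

Below : ℕ → Tm' → Set
Below n (var x) = x < n
Below n (lam x M) = x < n × Below n M
Below n (app M N) = Below n M × Below n N
Below n (proj₁ M) = Below n M
Below n (proj₂ M) = Below n M
Below n (case M x₁ N₁ x₂ N₂) = Below n M × x₁ < n × Below n N₁ × x₂ < n × Below n N₂
Below n (pair M N) = Below n M × Below n N
Below n (ω₁ M) = Below n M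
Below n (ω₂ M) = Below n M
Below n (mu α M) = α < n × Below n M
Below n (name α M) = α < n × Below n M

-- The bound variables introduced by the
-- translation ("α, γ, x fresh") are taken from the supply n, n+1, …;
-- the argument n is assumed to exceed every variable name of the source
-- term and context (see 'Below', 'CtxBelow'), and the supply is advanced
-- below each freshly introduced binder, so fresh names never clash.
tr : ℕ → Tm' → Tm
tr n (var x) = var x
tr n (lam x M) = lam x (tr n M)
tr n (app M N) = app (tr n M) (tr n N)
tr n (mu α M) = mu (ν α) (tr n M)
tr n (name α M) = name (ν α) (tr n M)
-- ⟨M,N⟩° = λx.(x M° N°)
tr n (pair M N) = lam n (app (app (var n) (tr (suc n) M)) (tr (suc n) N))
-- (M πᵢ)° = μα.(φ (M° λx₁.λx₂.μγ.(α xᵢ)))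
tr n (proj₁ M) = mu (ν n) (name φ (app (tr (2 + n) M)
                   (lam n (lam (suc n) (mu (ν (suc n)) (name (ν n) (var n)))))))
tr n (proj₂ M) = mu (ν n) (name φ (app (tr (2 + n) M)
                   (lam n (lam (suc n) (mu (ν (suc n)) (name (ν n) (var (suc n))))))))
-- (M [x₁.N₁,x₂.N₂])° = μα.(φ (M° λx₁.μγ.(α N₁°) λx₂.μγ.(α N₂°)))
tr n (case M x₁ N₁ x₂ N₂) =
  mu (ν n) (name φ (app (app (tr (2 + n) M)
                              (lam x₁ (mu (ν (suc n)) (name (ν n) (tr (2 + n) N₁)))))
                         (lam x₂ (mu (ν (suc n)) (name (ν n) (tr (2 + n) N₂))))))
-- (ωᵢ M)° = λx₁.λx₂.(xᵢ M°)
tr n (ω₁ M) = lam n (lam (suc n) (app (var n) (tr (2 + n) M)))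
tr n (ω₂ M) = lam n (lam (suc n) (app (var (suc n)) (tr (2 + n) M)))

-- Contexts: lists of declarations x : A and α : ¬B (the latter stored
-- as 'mdecl α B').

data Decl (MV T : Set) : Set where
  tdecl : ℕ → T → Decl MV T
  mdecl : MV → T → Decl MV T

Ctx : Set → Set → Set
Ctx MV T = List (Decl MV T)

TDecl : ∀ {MV T} → ℕ → Ctx MV T → Set
TDecl x Γ = ∃ λ A → tdecl x A ∈ Γ

MDecl : ∀ {MV T} → MV → Ctx MV T → Set
MDecl α Γ = ∃ λ A → mdecl α A ∈ Γ

data WF {MV T : Set} : Ctx MV T → Set where
  []  : WF []
  t∷ : ∀ {Γ x A} → ¬ TDecl x Γ → WF Γ → WF (tdecl x A ∷ Γ)
  m∷ : ∀ {Γ α A} → ¬ MDecl α Γ → WF Γ → WF (mdecl α A ∷ Γ)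

CtxBelow : ∀ {Atom} → ℕ → Ctx ℕ (Ty' Atom) → Set
CtxBelow n Γ = All P Γ
  where
  P : _ → Set
  P (tdecl x _) = x < n
  P (mdecl α _) = α < n

trDecl : ∀ {Atom} → Decl ℕ (Ty' Atom) → Decl MVar (Ty Atom)
trDecl (tdecl x A) = tdecl x (A °)
trDecl (mdecl α A) = mdecl (ν α) (A °)

trCtx : ∀ {Atom} → Ctx ℕ (Ty' Atom) → Ctx MVar (Ty Atom)
trCtx Γ = mdecl φ ⊥' ∷ map trDecl Γ

module System {Atom I : Set} (X : I → Atom) (F : I → Ty' Atom) where

  infix 4 _≈_ _≈°_
  data _≈_ : Ty' Atom → Ty' Atom → Set where
    ax    : ∀ i → at (X i) ≈ F i
    refl  : ∀ {A} → A ≈ A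
    sym   : ∀ {A B} → A ≈ B → B ≈ A
    trans : ∀ {A B C} → A ≈ B → B ≈ C → A ≈ C
    ⇒-cong : ∀ {A A' B B'} → A ≈ A' → B ≈ B' → (A ⇒ B) ≈ (A' ⇒ B')
    ∧-cong : ∀ {A A' B B'} → A ≈ A' → B ≈ B' → (A ∧ B) ≈ (A' ∧ B')
    ∨-cong : ∀ {A A' B B'} → A ≈ A' → B ≈ B' → (A ∨ B) ≈ (A' ∨ B')

  data _≈°_ : Ty Atom → Ty Atom → Set where
    ax    : ∀ i → at (X i) ≈° (F i) °
    refl  : ∀ {A} → A ≈° A
    sym   : ∀ {A B} → A ≈° B → B ≈° A
    trans : ∀ {A B C} → A ≈° B → B ≈° C → A ≈° C
    ⇒-cong : ∀ {A A' B B'} → A ≈° A' → B ≈° B' → (A ⇒ B) ≈° (A' ⇒ B')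

  -- 𝒮^{→∧∨}_≈.  "Γ, x:A" is only formed when x is not declared in Γ.
  infix 3 _⊢_∶_ _⊢°_∶_
  data _⊢_∶_ : Ctx ℕ (Ty' Atom) → Tm' → Ty' Atom → Set where
    ax   : ∀ {Γ x A} → tdecl x A ∈ Γ → Γ ⊢ var x ∶ A
    →I   : ∀ {Γ x A B M} → ¬ TDecl x Γ → tdecl x A ∷ Γ ⊢ M ∶ B → Γ ⊢ lam x M ∶ A ⇒ B
    →E   : ∀ {Γ A B M N} → Γ ⊢ M ∶ A ⇒ B → Γ ⊢ N ∶ A → Γ ⊢ app M N ∶ B
    name : ∀ {Γ α A M} → mdecl α A ∈ Γ → Γ ⊢ M ∶ A → Γ ⊢ name α M ∶ ⊥'
    μI   : ∀ {Γ α A M} → ¬ MDecl α Γ → mdecl α A ∷ Γ ⊢ M ∶ ⊥' → Γ ⊢ mu α M ∶ A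
    ∧I   : ∀ {Γ A₁ A₂ M N} → Γ ⊢ M ∶ A₁ → Γ ⊢ N ∶ A₂ → Γ ⊢ pair M N ∶ A₁ ∧ A₂
    ∧E₁  : ∀ {Γ A₁ A₂ M} → Γ ⊢ M ∶ A₁ ∧ A₂ → Γ ⊢ proj₁ M ∶ A₁
    ∧E₂  : ∀ {Γ A₁ A₂ M} → Γ ⊢ M ∶ A₁ ∧ A₂ → Γ ⊢ proj₂ M ∶ A₂
    ∨I₁  : ∀ {Γ A₁ A₂ M} → Γ ⊢ M ∶ A₁ → Γ ⊢ ω₁ M ∶ A₁ ∨ A₂
    ∨I₂  : ∀ {Γ A₁ A₂ M} → Γ ⊢ M ∶ A₂ → Γ ⊢ ω₂ M ∶ A₁ ∨ A₂
    ∨E   : ∀ {Γ A₁ A₂ C M x₁ N₁ x₂ N₂} → Γ ⊢ M ∶ A₁ ∨ A₂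
         → ¬ TDecl x₁ Γ → tdecl x₁ A₁ ∷ Γ ⊢ N₁ ∶ C
         → ¬ TDecl x₂ Γ → tdecl x₂ A₂ ∷ Γ ⊢ N₂ ∶ C
         → Γ ⊢ case M x₁ N₁ x₂ N₂ ∶ C
    conv : ∀ {Γ A B M} → Γ ⊢ M ∶ A → A ≈ B → Γ ⊢ M ∶ B

  data _⊢°_∶_ : Ctx MVar (Ty Atom) → Tm → Ty Atom → Set where
    ax   : ∀ {Γ x A} → tdecl x A ∈ Γ → Γ ⊢° var x ∶ A
    →I   : ∀ {Γ x A B M} → ¬ TDecl x Γ → tdecl x A ∷ Γ ⊢° M ∶ B → Γ ⊢° lam x M ∶ A ⇒ B
    →E   : ∀ {Γ A B M N} → Γ ⊢° M ∶ A ⇒ B → Γ ⊢° N ∶ A → Γ ⊢° app M N ∶ B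
    name : ∀ {Γ α A M} → mdecl α A ∈ Γ → Γ ⊢° M ∶ A → Γ ⊢° name α M ∶ ⊥'
    μI   : ∀ {Γ α A M} → ¬ MDecl α Γ → mdecl α A ∷ Γ ⊢° M ∶ ⊥' → Γ ⊢° mu α M ∶ A
    conv : ∀ {Γ A B M} → Γ ⊢° M ∶ A → A ≈° B → Γ ⊢° M ∶ B

-- The only real work is bookkeeping of
-- names: the target context Δ consists of φ : ¬⊥, the translations of the
-- source declarations, and declarations of the fresh names n₀ ≤ k < m taken
-- from the supply, which the translation keeps strictly increasing under
-- each binder it introduces.  Names below n₀ are therefore declared in Δ
-- only if they are declared in the source context, which transports the
-- freshness side conditions of →I and μI; the supply m is fresh in Δ by
-- construction.
module Submission where

open import Defs
open import Data.Empty using (⊥-elim)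
open import Data.List using ([]; _∷_; map)
open import Data.List.Membership.Propositional using (_∈_)
open import Data.List.Membership.Propositional.Properties using (∈-map⁺)
open import Data.List.Relation.Unary.All as All using (All; []; _∷_)
open import Data.List.Relation.Unary.All.Properties using (map⁺)
open import Data.List.Relation.Unary.Any using (here; there)
open import Data.Nat using (ℕ; suc; _+_; _<_; _≤_)
open import Data.Nat.Properties using (<-irrefl; ≤-refl; n≤1+n; n<1+n; <-≤-trans; m≤n⇒m≤1+n; <⇒≱)
open import Data.Product using (_,_)
open import Data.Unit using (⊤; tt)
open import Function.Definitions using (Injective)
open import Relation.Binary.PropositionalEquality using (_≡_; refl)
open import Relation.Nullary using (¬_)

module _ {T : Set} where

  TermBelow : ℕ → Decl MVar T → Set
  TermBelow k (tdecl x _) = x < k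
  TermBelow k (mdecl _ _) = ⊤

  MuBelow : ℕ → Decl MVar T → Set
  MuBelow k (tdecl _ _) = ⊤
  MuBelow k (mdecl φ _) = ⊤
  MuBelow k (mdecl (ν α) _) = α < k

  TermBelow-mono : ∀ {k k'} → k ≤ k' → ∀ {d} → TermBelow k d → TermBelow k' d
  TermBelow-mono k≤k' {tdecl _ _} x<k = <-≤-trans x<k k≤k'
  TermBelow-mono k≤k' {mdecl _ _} tt = tt

  MuBelow-mono : ∀ {k k'} → k ≤ k' → ∀ {d} → MuBelow k d → MuBelow k' d
  MuBelow-mono k≤k' {tdecl _ _} tt = tt
  MuBelow-mono k≤k' {mdecl φ _} tt = tt
  MuBelow-mono k≤k' {mdecl (ν _) _} α<k = <-≤-trans α<k k≤k'

  term-fresh : ∀ {k Δ} → All (TermBelow k) Δ → ¬ TDecl k Δ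
  term-fresh below (_ , k∈Δ) = <-irrefl refl (All.lookup below k∈Δ)

  mu-fresh : ∀ {k Δ} → All (MuBelow k) Δ → ¬ MDecl (ν k) Δ
  mu-fresh below (_ , k∈Δ) = <-irrefl refl (All.lookup below k∈Δ)

  module _ {S : Set} where

    Traced : Ctx ℕ S → ℕ → Decl MVar T → Set
    Traced Γ n (tdecl x _) = x < n → TDecl x Γ
    Traced Γ n (mdecl φ _) = ⊤
    Traced Γ n (mdecl (ν α) _) = α < n → MDecl α Γ

    Traced-weaken : ∀ {Γ n e d} → Traced Γ n d → Traced (e ∷ Γ) n d
    Traced-weaken {d = tdecl _ _} traced x<n with traced x<n
    ... | A , x∈Γ = A , there x∈Γ
    Traced-weaken {d = mdecl φ _} tt = tt
    Traced-weaken {d = mdecl (ν _) _} traced α<n with traced α<n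
    ... | A , α∈Γ = A , there α∈Γ

    Traced-beyond : ∀ {Γ n m B} → n ≤ m → Traced Γ n (tdecl m B)
    Traced-beyond n≤m m<n = ⊥-elim (<⇒≱ m<n n≤m)

    Traced-beyond-mu : ∀ {Γ n m B} → n ≤ m → Traced Γ n (mdecl (ν m) B)
    Traced-beyond-mu n≤m m<n = ⊥-elim (<⇒≱ m<n n≤m)

module _ {Atom : Set} where

  -- Δ is Γ° extended by φ and by declarations of names in [n₀, m).
  record Extends (Γ : Ctx ℕ (Ty' Atom)) (Δ : Ctx MVar (Ty Atom)) (n₀ m : ℕ) : Set where
    field
      n₀≤m      : n₀ ≤ m
      embed     : ∀ {d} → d ∈ Γ → trDecl d ∈ Δ
      φ∈        : mdecl φ ⊥' ∈ Δ
      termBelow : All (TermBelow m) Δ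
      muBelow   : All (MuBelow m) Δ
      traced    : All (Traced Γ n₀) Δ
  open Extends

  module _ {Γ Δ n₀ m} (E : Extends Γ Δ n₀ m) where

    term-fresh-source : ∀ {x} → x < n₀ → ¬ TDecl x Γ → ¬ TDecl x Δ
    term-fresh-source x<n₀ x∉Γ (_ , x∈Δ) = x∉Γ (All.lookup (traced E) x∈Δ x<n₀)

    mu-fresh-source : ∀ {α} → α < n₀ → ¬ MDecl α Γ → ¬ MDecl (ν α) Δ
    mu-fresh-source α<n₀ α∉Γ (_ , α∈Δ) = α∉Γ (All.lookup (traced E) α∈Δ α<n₀)

    bind-term : ∀ {x A} → x < n₀ → Extends (tdecl x A ∷ Γ) (tdecl x (A °) ∷ Δ) n₀ m
    bind-term {x} {A} x<n₀ = record
      { n₀≤m      = n₀≤m E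
      ; embed     = λ { (here refl) → here refl ; (there d∈Γ) → there (embed E d∈Γ) }
      ; φ∈        = there (φ∈ E)
      ; termBelow = <-≤-trans x<n₀ (n₀≤m E) ∷ termBelow E
      ; muBelow   = tt ∷ muBelow E
      ; traced    = (λ _ → A , here refl) ∷ All.map Traced-weaken (traced E)
      }

    bind-mu : ∀ {α A} → α < n₀ → Extends (mdecl α A ∷ Γ) (mdecl (ν α) (A °) ∷ Δ) n₀ m
    bind-mu {α} {A} α<n₀ = record
      { n₀≤m      = n₀≤m E
      ; embed     = λ { (here refl) → here refl ; (there d∈Γ) → there (embed E d∈Γ) }
      ; φ∈        = there (φ∈ E)
      ; termBelow = tt ∷ termBelow E
      ; muBelow   = <-≤-trans α<n₀ (n₀≤m E) ∷ muBelow E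
      ; traced    = (λ _ → A , here refl) ∷ All.map Traced-weaken (traced E)
      }

    bump : Extends Γ Δ n₀ (suc m)
    bump = record
      { n₀≤m      = m≤n⇒m≤1+n (n₀≤m E)
      ; embed     = embed E
      ; φ∈        = φ∈ E
      ; termBelow = All.map (TermBelow-mono (n≤1+n m)) (termBelow E)
      ; muBelow   = All.map (MuBelow-mono (n≤1+n m)) (muBelow E)
      ; traced    = traced E
      }

  module _ {Γ Δ n₀ m} (E : Extends Γ Δ n₀ m) where

    declare-term : ∀ {B} → Extends Γ (tdecl m B ∷ Δ) n₀ (suc m)
    declare-term {B} = record
      { n₀≤m      = n₀≤m (bump E)
      ; embed     = λ d∈Γ → there (embed E d∈Γ)
      ; φ∈        = there (φ∈ E)
      ; termBelow = n<1+n m ∷ termBelow (bump E)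
      ; muBelow   = tt ∷ muBelow (bump E)
      ; traced    = Traced-beyond {B = B} (n₀≤m E) ∷ traced E
      }

    declare-mu : ∀ {B} → Extends Γ (mdecl (ν m) B ∷ Δ) n₀ (suc m)
    declare-mu {B} = record
      { n₀≤m      = n₀≤m (bump E)
      ; embed     = λ d∈Γ → there (embed E d∈Γ)
      ; φ∈        = there (φ∈ E)
      ; termBelow = tt ∷ termBelow (bump E)
      ; muBelow   = n<1+n m ∷ muBelow (bump E)
      ; traced    = Traced-beyond-mu {B = B} (n₀≤m E) ∷ traced E
      }

  trDecls-termBelow : ∀ {n} (Γ : Ctx ℕ (Ty' Atom)) → CtxBelow n Γ → All (TermBelow n) (map trDecl Γ)
  trDecls-termBelow [] [] = []
  trDecls-termBelow (tdecl _ _ ∷ Γ) (x<n ∷ below) = x<n ∷ trDecls-termBelow Γ below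
  trDecls-termBelow (mdecl _ _ ∷ Γ) (_ ∷ below) = tt ∷ trDecls-termBelow Γ below

  trDecls-muBelow : ∀ {n} (Γ : Ctx ℕ (Ty' Atom)) → CtxBelow n Γ → All (MuBelow n) (map trDecl Γ)
  trDecls-muBelow [] [] = []
  trDecls-muBelow (tdecl _ _ ∷ Γ) (_ ∷ below) = tt ∷ trDecls-muBelow Γ below
  trDecls-muBelow (mdecl _ _ ∷ Γ) (α<n ∷ below) = α<n ∷ trDecls-muBelow Γ below

  trCtx-extends : ∀ {Γ n} → CtxBelow n Γ → Extends Γ (trCtx Γ) n n
  trCtx-extends {Γ} {n} below = record
    { n₀≤m      = ≤-refl
    ; embed     = λ d∈Γ → there (∈-map⁺ trDecl d∈Γ)
    ; φ∈        = here refl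
    ; termBelow = tt ∷ trDecls-termBelow Γ below
    ; muBelow   = tt ∷ trDecls-muBelow Γ below
    ; traced    = tt ∷ map⁺ (All.tabulate trace)
    }
    where
    trace : ∀ {d} → d ∈ Γ → Traced Γ n (trDecl d)
    trace {tdecl _ A} x∈Γ _ = A , x∈Γ
    trace {mdecl _ A} α∈Γ _ = A , α∈Γ

module Translation {Atom I : Set} (X : I → Atom) (F : I → Ty' Atom) where
  open System X F
  open Extends

  ≈⇒≈° : ∀ {A B} → A ≈ B → A ° ≈° B °
  ≈⇒≈° (ax i) = ax i
  ≈⇒≈° refl = refl
  ≈⇒≈° (sym A≈B) = sym (≈⇒≈° A≈B)
  ≈⇒≈° (trans A≈B B≈C) = trans (≈⇒≈° A≈B) (≈⇒≈° B≈C)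
  ≈⇒≈° (⇒-cong A≈A' B≈B') = ⇒-cong (≈⇒≈° A≈A') (≈⇒≈° B≈B')
  ≈⇒≈° (∧-cong A≈A' B≈B') = ⇒-cong (⇒-cong (≈⇒≈° A≈A') (⇒-cong (≈⇒≈° B≈B') refl)) refl
  ≈⇒≈° (∨-cong A≈A' B≈B') =
    ⇒-cong (⇒-cong (≈⇒≈° A≈A') refl) (⇒-cong (⇒-cong (≈⇒≈° B≈B') refl) refl)

  -- The continuation λx₁.λx₂.μγ.(α xⱼ) of (M πᵢ)°, with x₁ = m, x₂ = 1+m, γ = 1+m and α = m.
  projection-typing : ∀ {Δ m A₁ A₂ C j}
    → All (TermBelow m) Δ → All (MuBelow m) Δ
    → tdecl j C ∈ tdecl (suc m) A₂ ∷ tdecl m A₁ ∷ mdecl (ν m) C ∷ Δ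
    → mdecl (ν m) C ∷ Δ ⊢° lam m (lam (suc m) (mu (ν (suc m)) (name (ν m) (var j)))) ∶ A₁ ⇒ (A₂ ⇒ ⊥')
  projection-typing {m = m} termB muB j∈ =
    →I (term-fresh (tt ∷ termB))
      (→I (term-fresh (n<1+n m ∷ tt ∷ All.map (TermBelow-mono (n≤1+n m)) termB))
        (μI (mu-fresh (tt ∷ tt ∷ n<1+n m ∷ All.map (MuBelow-mono (n≤1+n m)) muB))
          (name (there (there (there (here refl)))) (ax (there j∈)))))

  tr-sound : ∀ {Γ Δ n₀ m M A} → Extends Γ Δ n₀ m → Below n₀ M → Γ ⊢ M ∶ A → Δ ⊢° tr m M ∶ A °
  tr-sound E _ (ax x∈Γ) = ax (embed E x∈Γ)
  tr-sound E (x<n₀ , M<) (→I x∉Γ ⊢M) =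
    →I (term-fresh-source E x<n₀ x∉Γ) (tr-sound (bind-term E x<n₀) M< ⊢M)
  tr-sound E (M< , N<) (→E ⊢M ⊢N) = →E (tr-sound E M< ⊢M) (tr-sound E N< ⊢N)
  tr-sound E (_ , M<) (name α∈Γ ⊢M) = name (embed E α∈Γ) (tr-sound E M< ⊢M)
  tr-sound E (α<n₀ , M<) (μI α∉Γ ⊢M) =
    μI (mu-fresh-source E α<n₀ α∉Γ) (tr-sound (bind-mu E α<n₀) M< ⊢M)
  tr-sound E (M< , N<) (∧I ⊢M ⊢N) =
    →I (term-fresh (termBelow E))
      (→E (→E (ax (here refl)) (tr-sound (declare-term E) M< ⊢M)) (tr-sound (declare-term E) N< ⊢N))
  tr-sound E M< (∧E₁ ⊢M) =
    μI (mu-fresh (muBelow E)) (name (there (φ∈ E))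
      (→E (tr-sound (bump (declare-mu E)) M< ⊢M)
          (projection-typing (termBelow E) (muBelow E) (there (here refl)))))
  tr-sound E M< (∧E₂ ⊢M) =
    μI (mu-fresh (muBelow E)) (name (there (φ∈ E))
      (→E (tr-sound (bump (declare-mu E)) M< ⊢M)
          (projection-typing (termBelow E) (muBelow E) (here refl))))
  tr-sound E M< (∨I₁ ⊢M) =
    →I (term-fresh (termBelow E)) (→I (term-fresh (termBelow (declare-term E)))
      (→E (ax (there (here refl))) (tr-sound (declare-term (declare-term E)) M< ⊢M)))
  tr-sound E M< (∨I₂ ⊢M) =
    →I (term-fresh (termBelow E)) (→I (term-fresh (termBelow (declare-term E)))
      (→E (ax (here refl)) (tr-sound (declare-term (declare-term E)) M< ⊢M)))
  tr-sound {Γ} {Δ} {n₀} {m} {A = C} E (M< , x₁<n₀ , N₁< , x₂<n₀ , N₂<) (∨E ⊢M x₁∉Γ ⊢N₁ x₂∉Γ ⊢N₂) =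
    μI (mu-fresh (muBelow E)) (name (there (φ∈ E))
      (→E (→E (tr-sound (bump E′) M< ⊢M) (branch x₁<n₀ x₁∉Γ N₁< ⊢N₁)) (branch x₂<n₀ x₂∉Γ N₂< ⊢N₂)))
    where
    E′ : Extends Γ (mdecl (ν m) (C °) ∷ Δ) n₀ (suc m)
    E′ = declare-mu E

    branch : ∀ {x B N} → x < n₀ → ¬ TDecl x Γ → Below n₀ N → tdecl x B ∷ Γ ⊢ N ∶ C
           → mdecl (ν m) (C °) ∷ Δ ⊢° lam x (mu (ν (suc m)) (name (ν m) (tr (2 + m) N))) ∶ ¬' (B °)
    branch x<n₀ x∉Γ N< ⊢N =
      →I (term-fresh-source E′ x<n₀ x∉Γ)
        (μI (mu-fresh (muBelow (bind-term E′ x<n₀)))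
          (name (there (there (here refl))) (tr-sound (declare-mu (bind-term E′ x<n₀)) N< ⊢N)))
  tr-sound E M< (conv ⊢M A≈B) = conv (tr-sound E M< ⊢M) (≈⇒≈° A≈B)

lemma7p7 : (Atom I : Set) (X : I → Atom) → Injective _≡_ _≡_ X → (F : I → Ty' Atom)
    → let open System X F in
    (Γ : Ctx ℕ (Ty' Atom)) (M : Tm') (A : Ty' Atom) (n : ℕ)
    → WF Γ → CtxBelow n Γ → Below n M
    → Γ ⊢ M ∶ A
    → trCtx Γ ⊢° tr n M ∶ (A °)
lemma7p7 Atom I X _ F Γ M A n _ Γ-below M-below ⊢M =
  Translation.tr-sound X F (trCtx-extends Γ-below) M-below ⊢M
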